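{- Let $k\ge1$ and let $F_n^k(\mathbf z;q)=\sum_{\pi\in RLP_n^k}\big(\prod_j z_{\ell_j}\big)q^{\mathrm{maj}(\pi)}$ as in the context. Then $F_0^k(\mathbf z;q)=1$ and for $n\ge1$ $$F_n^k(\mathbf z;q)=\sum_{i=1}^k z_i\,q^{\binom{i}{2}}F_{n-i}^k(E_i\mathbf z;q),$$ where $F_n^k=0$ for $n<0$ and, for an integer $m$, $F_n^k(E_m\mathbf z;q)$ denotes $F_n^k$ evaluated at $(z_1,z_2q^{m},z_3q^{2m},\dots,z_kq^{(k-1)m})$ in place of $\mathbf z$.
   Context: For a composition $(\ell_1,\dots,\ell_r)$ of $n$, the reverse layered permutation of $[n]$ has first $\ell_1$ entries $1,\dots,\ell_1$ in decreasing order, next $\ell_2$ entries $\ell_1+1,\dots,\ell_1+\ell_2$ in decreasing order, etc.; these blocks are its layers. $RLP_n^k$ is the set of reverse layered permutations of $[n]$ with all layers of length at most $k$. $\mathbf z=(z_1,\dots,z_k)$ are indeterminates and $F_n^k(\mathbf z;q)$ is a polynomial in them and $q$. $\mathrm{maj}(\pi)$ is the sum of all $i$ with $\pi(i)>\pi(i+1)$. -}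

module Defs where

open import Algebra.Bundles using (CommutativeSemiring)
open import Data.Nat as ℕ using (ℕ; zero; suc; _≟_)
open import Data.Fin using (Fin; toℕ)
open import Data.List using (List; []; _∷_; map; concat; concatMap; filter; upTo; allFin; foldr)
open import Data.Integer as ℤ using (ℤ; +_; -[1+_])
open import Relation.Nullary.Decidable using (does)
open import Data.Bool using (if_then_else_)

-- A composition with all parts in {1,…,k} is encoded as a list of
-- elements of Fin k; the element i encodes the part length suc (toℕ i).
partLen : ∀ {k} → Fin k → ℕ
partLen i = suc (toℕ i)

listsOfLength : (k L : ℕ) → List (List (Fin k))
listsOfLength k zero    = [] ∷ []
listsOfLength k (suc L) = concatMap (λ i → map (i ∷_) (listsOfLength k L)) (allFin k)

sumParts : ∀ {k} → List (Fin k) → ℕ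
sumParts = foldr (λ i s → partLen i ℕ.+ s) 0

-- all compositions of n with parts of size at most k
-- (a composition of n has at most n parts)
compositions : (k n : ℕ) → List (List (Fin k))
compositions k n =
  filter (λ c → sumParts c ≟ n) (concatMap (listsOfLength k) (upTo (suc n)))

decBlock : ℕ → ℕ → List ℕ
decBlock s zero    = []
decBlock s (suc ℓ) = (s ℕ.+ suc ℓ) ∷ decBlock s ℓ

-- the reverse layered permutation (one-line notation) with the given
-- layer lengths, values starting after offset s
revLayeredFrom : ∀ {k} → ℕ → List (Fin k) → List ℕ
revLayeredFrom s []      = []
revLayeredFrom s (i ∷ c) = decBlock s (partLen i) Data.List.++ revLayeredFrom (s ℕ.+ partLen i) c

revLayered : ∀ {k} → List (Fin k) → List ℕ
revLayered = revLayeredFrom 0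

majFrom : ℕ → List ℕ → ℕ
majFrom p []           = 0
majFrom p (a ∷ [])     = 0
majFrom p (a ∷ b ∷ w)  =
  (if does (b ℕ.<? a) then p else 0) ℕ.+ majFrom (suc p) (b ∷ w)

maj : List ℕ → ℕ
maj = majFrom 1

module _ {c ℓ} (R : CommutativeSemiring c ℓ) where
  open CommutativeSemiring R

  pow : Carrier → ℕ → Carrier
  pow x zero    = 1#
  pow x (suc m) = x * pow x m

  sumR : List Carrier → Carrier
  sumR = foldr _+_ 0#

  prodR : List Carrier → Carrier
  prodR = foldr _*_ 1#

  F : (k n : ℕ) → (Fin k → Carrier) → Carrier → Carrier
  F k n z q =
    sumR (map (λ c → prodR (map z c) * pow q (maj (revLayered c)))
              (compositions k n))

  Fℤ : (k : ℕ) → ℤ → (Fin k → Carrier) → Carrier → Carrier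
  Fℤ k (+ n)    z q = F k n z q
  Fℤ k -[1+ n ] z q = 0#

  E : (k m : ℕ) → (Fin k → Carrier) → Carrier → (Fin k → Carrier)
  E k m z q j = z j * pow q (toℕ j ℕ.* m)

module Submission where

-- A reverse layered permutation is determined by its list of layer lengths
-- (ℓ_1, …, ℓ_r).  Its descents are exactly the positions inside layers, so
-- its major index has a closed form; writing ℓ = ℓ_1, removing the first
-- layer turns the major index into
--     maj(ℓ, ℓ_2, …) = C(ℓ,2) + ℓ·Σ_{j≥2}(ℓ_j − 1) + maj(ℓ_2, …),
-- and the middle term is exactly what the substitution z ↦ E_ℓ z produces
-- in the product of the z_{ℓ_j}.
--
-- On the algebraic side ('ListSums', 'RangeSums', 'Recurrence') F_n is
-- split by the number L of layers, F_n = Σ_{L ≤ n} G_L(n), where G_L(n)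
-- sums the weights of the length-L words of total n.  Removing the first
-- letter gives G_{L+1}(n) = Σ_i z_i q^{C(i,2)} G_L(n − i)(E_i z), and since
-- G_L(m) vanishes for L > m, summing over L yields the theorem.

open import Defs
open import Algebra.Bundles using (CommutativeSemiring)
open import Data.Nat using (ℕ; suc; _≤_)
open import Data.Nat.Combinatorics using (_C_)
open import Data.Fin using (Fin; toℕ)
open import Data.List using (map; allFin)
open import Data.Integer using (_⊖_)
open import Data.Product using (_×_; _,_)

module LayeredMajorIndex where
  open import Data.Nat
  open import Data.Nat.Properties
  open import Data.Nat.Combinatorics using (nC1≡n; nCk+nC[k+1]≡[n+1]C[k+1])
  open import Data.Unit using (⊤)
  open import Data.List using (List; []; _∷_; _++_)
  open import Data.Bool using (if_then_else_)
  open import Relation.Binary.PropositionalEquality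
  open import Relation.Nullary.Decidable using (does; dec-true; dec-false)
  open import Algebra.Properties.CommutativeSemigroup +-commutativeSemigroup
    using (x∙yz≈y∙xz; interchange)
  open ≡-Reasoning

  -- staircase p j = p + (p+1) + ⋯ + (p+j−1): the descents of a decreasing
  -- block of length j+1 whose first entry sits at position p.
  staircase : ℕ → ℕ → ℕ
  staircase p zero    = 0
  staircase p (suc j) = p + staircase (suc p) j

  staircase-suc : ∀ p j → staircase (suc p) j ≡ j + staircase p j
  staircase-suc p zero    = refl
  staircase-suc p (suc j) = begin
    suc p + staircase (suc (suc p)) j  ≡⟨ cong (suc p +_) (staircase-suc (suc p) j) ⟩
    suc p + (j + staircase (suc p) j)  ≡⟨ cong suc (x∙yz≈y∙xz p j _) ⟩
    suc j + (p + staircase (suc p) j)  ∎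

  -- Moving the block t positions to the right adds t to each of its j descents.
  staircase-shift : ∀ t p j → staircase (t + p) j ≡ j * t + staircase p j
  staircase-shift zero    p j = cong (_+ staircase p j) (sym (*-zeroʳ j))
  staircase-shift (suc t) p j = begin
    staircase (suc (t + p)) j      ≡⟨ staircase-suc (t + p) j ⟩
    j + staircase (t + p) j        ≡⟨ cong (j +_) (staircase-shift t p j) ⟩
    j + (j * t + staircase p j)    ≡⟨ sym (+-assoc j (j * t) _) ⟩
    j + j * t + staircase p j      ≡⟨ cong (_+ staircase p j) (sym (*-suc j t)) ⟩
    j * suc t + staircase p j      ∎

  -- A leading block of length j+1 contributes 1 + 2 + ⋯ + j = C(j+1, 2).
  staircase-binomial : ∀ j → staircase 1 j ≡ suc j C 2
  staircase-binomial zero    = refl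
  staircase-binomial (suc j) = begin
    suc (staircase 2 j)              ≡⟨ cong suc (staircase-suc 1 j) ⟩
    suc j + staircase 1 j            ≡⟨ cong₂ _+_ (sym (nC1≡n (suc j))) (staircase-binomial j) ⟩
    suc j C 1 + suc j C 2            ≡⟨ nCk+nC[k+1]≡[n+1]C[k+1] (suc j) 1 ⟩
    suc (suc j) C 2                  ∎

  StartsAbove : ℕ → List ℕ → Set
  StartsAbove a []      = ⊤
  StartsAbove a (b ∷ _) = a < b

  -- Reading a decreasing block (its last entry s+1) followed by a word that
  -- starts higher: the block yields its staircase and no descent at the seam.
  majFrom-block : ∀ s j p w → StartsAbove (s + 1) w →
    majFrom p (decBlock s (suc j) ++ w) ≡ staircase p j + majFrom (suc j + p) w
  majFrom-block s zero p []      _     = refl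
  majFrom-block s zero p (b ∷ w) s+1<b =
    cong (λ d → (if d then p else 0) + majFrom (suc p) (b ∷ w))
         (dec-false (b <? s + 1) (<-asym s+1<b))
  majFrom-block s (suc j) p w above = begin
    (if does (s + suc j <? s + suc (suc j)) then p else 0)
      + majFrom (suc p) (decBlock s (suc j) ++ w)
        ≡⟨ cong₂ _+_ descent (majFrom-block s j (suc p) w above) ⟩
    p + (staircase (suc p) j + majFrom (suc j + suc p) w)
        ≡⟨ sym (+-assoc p _ _) ⟩
    p + staircase (suc p) j + majFrom (suc j + suc p) w
        ≡⟨ cong (λ x → p + staircase (suc p) j + majFrom x w) (+-suc (suc j) p) ⟩
    p + staircase (suc p) j + majFrom (suc (suc j) + p) w ∎
    where
    descent : (if does (s + suc j <? s + suc (suc j)) then p else 0) ≡ p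
    descent = cong (λ d → if d then p else 0)
      (dec-true (s + suc j <? s + suc (suc j)) (+-monoʳ-< s (n<1+n (suc j))))

  module _ {k : ℕ} where

    revLayeredFrom-startsAbove : ∀ a t (c : List (Fin k)) → a ≤ t →
      StartsAbove a (revLayeredFrom t c)
    revLayeredFrom-startsAbove a t []      _   = _
    revLayeredFrom-startsAbove a t (i ∷ c) a≤t = ≤-<-trans a≤t (m<m+n t (s≤s z≤n))

    -- Closed form of the major index of a reverse layered word whose first
    -- entry sits at position p: one staircase per layer.
    layerMaj : ℕ → List (Fin k) → ℕ
    layerMaj p []      = 0
    layerMaj p (i ∷ c) = staircase p (toℕ i) + layerMaj (partLen i + p) c

    majFrom-revLayered : ∀ s p (c : List (Fin k)) →
      majFrom p (revLayeredFrom s c) ≡ layerMaj p c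
    majFrom-revLayered s p []      = refl
    majFrom-revLayered s p (i ∷ c) = begin
      majFrom p (decBlock s (partLen i) ++ revLayeredFrom (s + partLen i) c)
        ≡⟨ majFrom-block s (toℕ i) p _ (revLayeredFrom-startsAbove (s + 1) (s + partLen i) c
             (+-monoʳ-≤ s (s≤s z≤n))) ⟩
      staircase p (toℕ i) + majFrom (partLen i + p) (revLayeredFrom (s + partLen i) c)
        ≡⟨ cong (staircase p (toℕ i) +_) (majFrom-revLayered (s + partLen i) (partLen i + p) c) ⟩
      layerMaj p (i ∷ c) ∎

    -- shiftExponent m c = m · Σ_j (ℓ_j − 1): the power of q produced by
    -- substituting E_m z for z in the product of the z_{ℓ_j}.
    shiftExponent : ℕ → List (Fin k) → ℕ
    shiftExponent m []      = 0
    shiftExponent m (i ∷ c) = toℕ i * m + shiftExponent m c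

    -- Starting m positions later shifts every descent by m.
    layerMaj-shift : ∀ m p c → layerMaj (m + p) c ≡ shiftExponent m c + layerMaj p c
    layerMaj-shift m p []      = refl
    layerMaj-shift m p (i ∷ c) = begin
      staircase (m + p) (toℕ i) + layerMaj (partLen i + (m + p)) c
        ≡⟨ cong₂ _+_ (staircase-shift m p (toℕ i))
                      (trans (cong (λ x → layerMaj x c) (x∙yz≈y∙xz (partLen i) m p))
                             (layerMaj-shift m (partLen i + p) c)) ⟩
      (toℕ i * m + staircase p (toℕ i)) + (shiftExponent m c + layerMaj (partLen i + p) c)
        ≡⟨ interchange (toℕ i * m) (staircase p (toℕ i)) (shiftExponent m c) _ ⟩
      (toℕ i * m + shiftExponent m c) + (staircase p (toℕ i) + layerMaj (partLen i + p) c) ∎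

    maj-cons : ∀ (i : Fin k) c → maj (revLayered (i ∷ c)) ≡
      partLen i C 2 + (shiftExponent (partLen i) c + maj (revLayered c))
    maj-cons i c = begin
      maj (revLayered (i ∷ c))                     ≡⟨ majFrom-revLayered 0 1 (i ∷ c) ⟩
      staircase 1 (toℕ i) + layerMaj (partLen i + 1) c
        ≡⟨ cong₂ _+_ (staircase-binomial (toℕ i)) (layerMaj-shift (partLen i) 1 c) ⟩
      partLen i C 2 + (shiftExponent (partLen i) c + layerMaj 1 c)
        ≡⟨ cong (λ x → partLen i C 2 + (shiftExponent (partLen i) c + x))
                (sym (majFrom-revLayered 0 1 c)) ⟩
      partLen i C 2 + (shiftExponent (partLen i) c + maj (revLayered c)) ∎

module ListSums {c ℓ} (R : CommutativeSemiring c ℓ) where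
  open CommutativeSemiring R
  open import Data.List using (List; []; _∷_; _++_; concatMap; filter)
  open import Data.Bool using (Bool; true; false; if_then_else_)
  open import Relation.Nullary.Decidable using (does)
  open import Relation.Unary using (Pred; Decidable)
  open import Relation.Binary.PropositionalEquality as ≡ using (_≡_)
  open import Algebra.Properties.CommutativeSemigroup +-commutativeSemigroup
    using (interchange)

  sumOver : {A : Set} → List A → (A → Carrier) → Carrier
  sumOver xs f = sumR R (map f xs)

  when : Bool → Carrier → Carrier
  when b x = if b then x else 0#

  when-cong : ∀ b {x y} → x ≈ y → when b x ≈ when b y
  when-cong true  x≈y = x≈y
  when-cong false _   = refl

  when-scale : ∀ b a x → when b (a * x) ≈ a * when b x
  when-scale true  a x = refl
  when-scale false a x = sym (zeroʳ a)

  sumOver-cong : ∀ {A : Set} (xs : List A) {f g} → (∀ x → f x ≈ g x) →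
    sumOver xs f ≈ sumOver xs g
  sumOver-cong []       f≈g = refl
  sumOver-cong (x ∷ xs) f≈g = +-cong (f≈g x) (sumOver-cong xs f≈g)

  sumOver-zero : ∀ {A : Set} (xs : List A) {f} → (∀ x → f x ≈ 0#) → sumOver xs f ≈ 0#
  sumOver-zero []       f≈0 = refl
  sumOver-zero (x ∷ xs) f≈0 = trans (+-cong (f≈0 x) (sumOver-zero xs f≈0)) (+-identityˡ 0#)

  sumOver-++ : ∀ {A : Set} (xs ys : List A) f →
    sumOver (xs ++ ys) f ≈ sumOver xs f + sumOver ys f
  sumOver-++ []       ys f = sym (+-identityˡ _)
  sumOver-++ (x ∷ xs) ys f = trans (+-cong refl (sumOver-++ xs ys f)) (sym (+-assoc _ _ _))

  sumOver-concatMap : ∀ {A B : Set} (h : A → List B) (xs : List A) f →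
    sumOver (concatMap h xs) f ≈ sumOver xs (λ x → sumOver (h x) f)
  sumOver-concatMap h []       f = refl
  sumOver-concatMap h (x ∷ xs) f =
    trans (sumOver-++ (h x) (concatMap h xs) f) (+-cong refl (sumOver-concatMap h xs f))

  sumOver-map : ∀ {A B : Set} (h : A → B) (xs : List A) f →
    sumOver (map h xs) f ≡ sumOver xs (λ x → f (h x))
  sumOver-map h []       f = ≡.refl
  sumOver-map h (x ∷ xs) f = ≡.cong (f (h x) +_) (sumOver-map h xs f)

  sumOver-+ : ∀ {A : Set} (xs : List A) f g →
    sumOver xs f + sumOver xs g ≈ sumOver xs (λ x → f x + g x)
  sumOver-+ []       f g = +-identityˡ 0#
  sumOver-+ (x ∷ xs) f g = trans (interchange _ _ _ _) (+-cong refl (sumOver-+ xs f g))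

  sumOver-scale : ∀ {A : Set} (xs : List A) a f →
    a * sumOver xs f ≈ sumOver xs (λ x → a * f x)
  sumOver-scale []       a f = zeroʳ a
  sumOver-scale (x ∷ xs) a f = trans (distribˡ _ _ _) (+-cong refl (sumOver-scale xs a f))

  sumOver-filter : ∀ {A : Set} {p} {Q : Pred A p} (Q? : Decidable Q) (xs : List A) g →
    sumOver (filter Q? xs) g ≈ sumOver xs (λ x → when (does (Q? x)) (g x))
  sumOver-filter Q? []       g = refl
  sumOver-filter Q? (x ∷ xs) g with does (Q? x)
  ... | true  = +-cong refl (sumOver-filter Q? xs g)
  ... | false = trans (sumOver-filter Q? xs g) (sym (+-identityˡ _))

module RangeSums {c ℓ} (R : CommutativeSemiring c ℓ) where
  open CommutativeSemiring R
  open ListSums R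
  open import Data.Nat using (zero; z≤n; s≤s)
  open import Data.List using (List; applyUpTo)
  open import Relation.Binary.PropositionalEquality as ≡ using (_≡_)

  sumBelow : ℕ → (ℕ → Carrier) → Carrier
  sumBelow zero    h = 0#
  sumBelow (suc N) h = h 0 + sumBelow N (λ L → h (suc L))

  sumOver-applyUpTo : ∀ {B : Set} (f : ℕ → B) N g →
    sumOver (applyUpTo f N) g ≡ sumBelow N (λ L → g (f L))
  sumOver-applyUpTo f zero    g = ≡.refl
  sumOver-applyUpTo f (suc N) g = ≡.cong (g (f 0) +_) (sumOver-applyUpTo (λ L → f (suc L)) N g)

  sumBelow-cong : ∀ N {h h′} → (∀ L → h L ≈ h′ L) → sumBelow N h ≈ sumBelow N h′
  sumBelow-cong zero    h≈h′ = refl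
  sumBelow-cong (suc N) h≈h′ = +-cong (h≈h′ 0) (sumBelow-cong N (λ L → h≈h′ (suc L)))

  sumBelow-zero : ∀ N {h} → (∀ L → h L ≈ 0#) → sumBelow N h ≈ 0#
  sumBelow-zero zero    h≈0 = refl
  sumBelow-zero (suc N) h≈0 =
    trans (+-cong (h≈0 0) (sumBelow-zero N (λ L → h≈0 (suc L)))) (+-identityˡ 0#)

  sumBelow-truncate : ∀ M N {h} → (∀ L → M ≤ L → h L ≈ 0#) → M ≤ N →
    sumBelow N h ≈ sumBelow M h
  sumBelow-truncate zero    N       vanish _         = sumBelow-zero N (λ L → vanish L z≤n)
  sumBelow-truncate (suc M) (suc N) vanish (s≤s M≤N) =
    +-cong refl (sumBelow-truncate M N (λ L M≤L → vanish (suc L) (s≤s M≤L)) M≤N)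

  sumBelow-scale : ∀ N {h} a → a * sumBelow N h ≈ sumBelow N (λ L → a * h L)
  sumBelow-scale zero    a = zeroʳ a
  sumBelow-scale (suc N) a = trans (distribˡ _ _ _) (+-cong refl (sumBelow-scale N a))

  sumBelow-sumOver : ∀ {A : Set} (xs : List A) N f →
    sumBelow N (λ L → sumOver xs (f L)) ≈ sumOver xs (λ x → sumBelow N (λ L → f L x))
  sumBelow-sumOver xs zero    f = sym (sumOver-zero xs (λ _ → refl))
  sumBelow-sumOver xs (suc N) f =
    trans (+-cong refl (sumBelow-sumOver xs N (λ L → f (suc L)))) (sumOver-+ xs _ _)

module IntegerDifference where
  open import Data.Nat using (_<_; _∸_; _≤?_)
  open import Data.Nat.Properties using (≰⇒>; m<n⇒0<n∸m)
  open import Relation.Nullary.Decidable using (yes; no)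
  open import Data.Integer using (ℤ; +_; -[1+_])
  open import Data.Integer.Properties using (⊖-≥; ⊖-<)

  data DifferenceView (n l : ℕ) : ℤ → Set where
    nonnegative : l ≤ n → DifferenceView n l (+ (n ∸ l))
    negative    : ∀ j → n < l → DifferenceView n l -[1+ j ]

  differenceView : ∀ n l → DifferenceView n l (n ⊖ l)
  differenceView n l with l ≤? n
  ... | yes l≤n rewrite ⊖-≥ l≤n = nonnegative l≤n
  -- In the negative case l ∸ n is positive, so it has the form suc j.
  ... | no l≰n with l ∸ n | m<n⇒0<n∸m (≰⇒> l≰n) | ⊖-< (≰⇒> l≰n)
  ...   | suc j | _ | n⊖l≡-[1+j] rewrite n⊖l≡-[1+j] = negative j (≰⇒> l≰n)

module Recurrence {c ℓ} (R : CommutativeSemiring c ℓ) (k : ℕ)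
                  (q : CommutativeSemiring.Carrier R) where
  open CommutativeSemiring R
  open ListSums R
  open RangeSums R
  open LayeredMajorIndex
  open IntegerDifference
  open import Relation.Binary.Reasoning.Setoid setoid
  open import Data.Nat as ℕ using (zero; z≤n; s≤s; _∸_)
  import Data.Nat.Properties as ℕ
  open import Data.Integer using (ℤ; +_; -[1+_])
  open import Data.List using (List; []; _∷_; concatMap; upTo)
  open import Relation.Nullary.Decidable using (does; dec-false; does-⇔)
  open import Relation.Binary.PropositionalEquality as ≡ using (_≡_)
  open import Function.Bundles using (mk⇔)
  open import Algebra.Properties.CommutativeSemigroup *-commutativeSemigroup
    using (interchange)

  Word : Set
  Word = List (Fin k)

  Weights : Set c
  Weights = Fin k → Carrier

  pow-+ : ∀ a b → pow R q (a ℕ.+ b) ≈ pow R q a * pow R q b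
  pow-+ zero    b = sym (*-identityˡ _)
  pow-+ (suc a) b = trans (*-cong refl (pow-+ a b)) (sym (*-assoc _ _ _))

  weight : Weights → Word → Carrier
  weight z c = prodR R (map z c) * pow R q (maj (revLayered c))

  leading : Weights → Fin k → Carrier
  leading z i = z i * pow R q (partLen i C 2)

  product-E : ∀ m z (c : Word) →
    prodR R (map (E R k m z q) c) ≈ prodR R (map z c) * pow R q (shiftExponent m c)
  product-E m z []      = sym (*-identityˡ 1#)
  product-E m z (i ∷ c) = begin
    (z i * pow R q (toℕ i ℕ.* m)) * prodR R (map (E R k m z q) c)
      ≈⟨ *-cong refl (product-E m z c) ⟩
    (z i * pow R q (toℕ i ℕ.* m)) * (prodR R (map z c) * pow R q (shiftExponent m c))
      ≈⟨ interchange _ _ _ _ ⟩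
    (z i * prodR R (map z c)) * (pow R q (toℕ i ℕ.* m) * pow R q (shiftExponent m c))
      ≈⟨ *-cong refl (sym (pow-+ (toℕ i ℕ.* m) (shiftExponent m c))) ⟩
    (z i * prodR R (map z c)) * pow R q (toℕ i ℕ.* m ℕ.+ shiftExponent m c) ∎

  weight-cons : ∀ z (i : Fin k) c →
    weight z (i ∷ c) ≈ leading z i * weight (E R k (partLen i) z q) c
  weight-cons z i c = begin
    (z i * P) * pow R q (maj (revLayered (i ∷ c)))
      ≡⟨ ≡.cong (λ x → (z i * P) * pow R q x) (maj-cons i c) ⟩
    (z i * P) * pow R q (len C 2 ℕ.+ (shiftExponent len c ℕ.+ maj (revLayered c)))
      ≈⟨ *-cong refl (trans (pow-+ (len C 2) _) (*-cong refl (pow-+ (shiftExponent len c) _))) ⟩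
    (z i * P) * (pow R q (len C 2) * (Q * pow R q (maj (revLayered c))))
      ≈⟨ interchange _ _ _ _ ⟩
    leading z i * (P * (Q * pow R q (maj (revLayered c))))
      ≈⟨ *-cong refl (sym (*-assoc _ _ _)) ⟩
    leading z i * ((P * Q) * pow R q (maj (revLayered c)))
      ≈⟨ *-cong refl (*-cong (sym (product-E len z c)) refl) ⟩
    leading z i * weight (E R k len z q) c ∎
    where
    len : ℕ
    len = partLen i
    P Q : Carrier
    P = prodR R (map z c)
    Q = pow R q (shiftExponent len c)

  weightIf : Weights → ℕ → Word → Carrier
  weightIf z m c = when (does (sumParts c ℕ.≟ m)) (weight z c)

  weightIfℤ : Weights → ℤ → Word → Carrier
  weightIfℤ z (+ m)    c = weightIf z m c
  weightIfℤ z -[1+ _ ] c = 0#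

  G : Weights → ℕ → ℕ → Carrier
  G z L m = sumOver (listsOfLength k L) (weightIf z m)

  Gℤ : Weights → ℕ → ℤ → Carrier
  Gℤ z L x = sumOver (listsOfLength k L) (weightIfℤ z x)

  -- A composition of m has at most m parts.
  F-by-length : ∀ z m → F R k m z q ≈ sumBelow (suc m) (λ L → G z L m)
  F-by-length z m = begin
    F R k m z q
      ≈⟨ sumOver-filter (λ c → sumParts c ℕ.≟ m) (concatMap (listsOfLength k) (upTo (suc m))) _ ⟩
    sumOver (concatMap (listsOfLength k) (upTo (suc m))) (weightIf z m)
      ≈⟨ sumOver-concatMap (listsOfLength k) (upTo (suc m)) (weightIf z m) ⟩
    sumOver (upTo (suc m)) (λ L → G z L m)
      ≡⟨ sumOver-applyUpTo (λ L → L) (suc m) (λ L → G z L m) ⟩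
    sumBelow (suc m) (λ L → G z L m) ∎

  -- Words of length L have at least L as sum of parts.
  sumOver-words-vanish : ∀ L (g : Word → Carrier) → (∀ c → L ℕ.≤ sumParts c → g c ≈ 0#) →
    sumOver (listsOfLength k L) g ≈ 0#
  sumOver-words-vanish zero    g vanish = trans (+-identityʳ _) (vanish [] z≤n)
  sumOver-words-vanish (suc L) g vanish =
    trans (sumOver-concatMap (λ i → map (i ∷_) (listsOfLength k L)) (allFin k) g)
      (sumOver-zero (allFin k) λ i →
        trans (reflexive (sumOver-map (i ∷_) (listsOfLength k L) g))
          (sumOver-words-vanish L (λ c → g (i ∷ c)) λ c L≤c →
            vanish (i ∷ c) (s≤s (ℕ.≤-trans L≤c (ℕ.m≤n+m _ _)))))

  G-vanish : ∀ z L m → m ℕ.< L → G z L m ≈ 0#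
  G-vanish z L m m<L = sumOver-words-vanish L (weightIf z m) λ c L≤c →
    reflexive (≡.cong (λ b → when b (weight z c))
      (dec-false (sumParts c ℕ.≟ m) (λ c≡m → ℕ.<⇒≢ (ℕ.<-≤-trans m<L L≤c) (≡.sym c≡m))))

  parts-shift : ∀ {l n} s → l ℕ.≤ n → does (l ℕ.+ s ℕ.≟ n) ≡ does (s ℕ.≟ n ∸ l)
  parts-shift {l} {n} s l≤n = does-⇔ (mk⇔
    (λ l+s≡n → ≡.trans (≡.sym (ℕ.m+n∸m≡n l s)) (≡.cong (_∸ l) l+s≡n))
    (λ s≡n∸l → ≡.trans (≡.cong (l ℕ.+_) s≡n∸l) (ℕ.m+[n∸m]≡n l≤n)))
    (l ℕ.+ s ℕ.≟ n) (s ℕ.≟ n ∸ l)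

  weightIf-cons : ∀ z n (i : Fin k) c →
    weightIf z n (i ∷ c) ≈ leading z i * weightIfℤ (E R k (partLen i) z q) (n ⊖ partLen i) c
  weightIf-cons z n i c with n ⊖ partLen i | differenceView n (partLen i)
  ... | _ | nonnegative ℓ≤n = begin
    when (does (partLen i ℕ.+ sumParts c ℕ.≟ n)) (weight z (i ∷ c))
      ≈⟨ when-cong _ (weight-cons z i c) ⟩
    when (does (partLen i ℕ.+ sumParts c ℕ.≟ n)) (leading z i * weight z′ c)
      ≈⟨ when-scale _ _ _ ⟩
    leading z i * when (does (partLen i ℕ.+ sumParts c ℕ.≟ n)) (weight z′ c)
      ≡⟨ ≡.cong (λ b → leading z i * when b (weight z′ c)) (parts-shift (sumParts c) ℓ≤n) ⟩
    leading z i * weightIf z′ (n ∸ partLen i) c ∎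
    where
    z′ : Weights
    z′ = E R k (partLen i) z q
  ... | _ | negative _ n<ℓ = begin
    when (does (partLen i ℕ.+ sumParts c ℕ.≟ n)) (weight z (i ∷ c))
      ≡⟨ ≡.cong (λ b → when b (weight z (i ∷ c))) (dec-false (partLen i ℕ.+ sumParts c ℕ.≟ n)
           (λ ℓ+s≡n → ℕ.<⇒≱ n<ℓ (≡.subst (partLen i ℕ.≤_) ℓ+s≡n (ℕ.m≤m+n _ _)))) ⟩
    0#            ≈⟨ sym (zeroʳ _) ⟩
    leading z i * 0# ∎

  G-step : ∀ z L n → G z (suc L) n ≈
    sumOver (allFin k) (λ i → leading z i * Gℤ (E R k (partLen i) z q) L (n ⊖ partLen i))
  G-step z L n =
    trans (sumOver-concatMap (λ i → map (i ∷_) (listsOfLength k L)) (allFin k) (weightIf z n))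
      (sumOver-cong (allFin k) λ i → begin
        sumOver (map (i ∷_) (listsOfLength k L)) (weightIf z n)
          ≡⟨ sumOver-map (i ∷_) (listsOfLength k L) (weightIf z n) ⟩
        sumOver (listsOfLength k L) (λ c → weightIf z n (i ∷ c))
          ≈⟨ sumOver-cong (listsOfLength k L) (weightIf-cons z n i) ⟩
        sumOver (listsOfLength k L) (λ c → leading z i * weightIfℤ _ (n ⊖ partLen i) c)
          ≈⟨ sym (sumOver-scale (listsOfLength k L) (leading z i) _) ⟩
        leading z i * Gℤ _ L (n ⊖ partLen i) ∎)

  -- Since n − l < n for l ≥ 1, summing over fewer than n parts already gives
  -- all of F_{n−l} (and 0 when n − l is negative).
  Fℤ-by-length : ∀ z n l → 1 ℕ.≤ l →
    sumBelow n (λ L → Gℤ z L (n ⊖ l)) ≈ Fℤ R k (n ⊖ l) z q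
  Fℤ-by-length z n l 1≤l with n ⊖ l | differenceView n l
  ... | _ | negative _ _   = sumBelow-zero n (λ L → sumOver-zero (listsOfLength k L) (λ _ → refl))
  ... | _ | nonnegative l≤n = begin
    sumBelow n (λ L → G z L (n ∸ l))
      ≈⟨ sumBelow-truncate (suc (n ∸ l)) n (λ L → G-vanish z L (n ∸ l)) (ℕ.∸-monoʳ-< {n} {l} {0} 1≤l l≤n) ⟩
    sumBelow (suc (n ∸ l)) (λ L → G z L (n ∸ l))
      ≈⟨ sym (F-by-length z (n ∸ l)) ⟩
    F R k (n ∸ l) z q ∎

  -- The only composition of 0 is the empty one.
  F-zero : ∀ z → F R k 0 z q ≈ 1#
  F-zero z = trans (+-identityʳ _) (*-identityˡ 1#)

  F-recurrence : ∀ z n → 1 ℕ.≤ n → F R k n z q ≈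
    sumOver (allFin k) (λ i → leading z i * Fℤ R k (n ⊖ partLen i) (E R k (partLen i) z q) q)
  F-recurrence z n@(suc _) _ = begin
    F R k n z q                                                ≈⟨ F-by-length z n ⟩
    G z 0 n + sumBelow n (λ L → G z (suc L) n)                 ≈⟨ +-cong (+-identityʳ _) refl ⟩
    0# + sumBelow n (λ L → G z (suc L) n)                      ≈⟨ +-identityˡ _ ⟩
    sumBelow n (λ L → G z (suc L) n)                           ≈⟨ sumBelow-cong n (λ L → G-step z L n) ⟩
    sumBelow n (λ L → sumOver (allFin k) (λ i → leading z i * Gℤ (z′ i) L (n ⊖ partLen i)))
      ≈⟨ sumBelow-sumOver (allFin k) n (λ L i → leading z i * Gℤ (z′ i) L (n ⊖ partLen i)) ⟩
    sumOver (allFin k) (λ i → sumBelow n (λ L → leading z i * Gℤ (z′ i) L (n ⊖ partLen i)))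
      ≈⟨ sumOver-cong (allFin k) (λ i →
           trans (sym (sumBelow-scale n {λ L → Gℤ (z′ i) L (n ⊖ partLen i)} (leading z i)))
                 (*-cong refl (Fℤ-by-length (z′ i) n (partLen i) (s≤s z≤n)))) ⟩
    sumOver (allFin k) (λ i → leading z i * Fℤ R k (n ⊖ partLen i) (z′ i) q) ∎
    where
    z′ : Fin k → Weights
    z′ i = E R k (partLen i) z q

mainTheorem14 : ∀ {c ℓ} (R : CommutativeSemiring c ℓ) (k : ℕ) → 1 ≤ k →
    let open CommutativeSemiring R in
    (z : Fin k → Carrier) (q : Carrier) →
    (F R k 0 z q ≈ 1#) ×
    (∀ (n : ℕ) → 1 ≤ n →
    F R k n z q ≈
    sumR R (map (λ (i : Fin k) →
    z i * pow R q (suc (toℕ i) C 2)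
    * Fℤ R k (n ⊖ suc (toℕ i)) (E R k (suc (toℕ i)) z q) q)
    (allFin k)))
mainTheorem14 R k _ z q = F-zero z , F-recurrence z
  where open Recurrence R k q
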